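{- Let $T$ be a roommate instance, $\mathcal{M}'\subseteq\mathcal{M}(T)$, and let $\tilde T$ be the subtable of $T$ whose edges are those belonging to some $M\in\mathcal{M}'$. If $\mathcal{M}'$ is internally closed, then $\mathcal{M}'=\mathcal{S}(\tilde T)$.
   Context: Roommate instance $T$: finite agent set; each agent $z$ has a strictly ordered ($>_z$) list of acceptable agents, acceptability symmetric; acceptable pairs are edges. Matchings, $M(z)$ (partner or $\emptyset$, least preferred); edge $ab$ blocks $M$ if $b>_aM(a)$ and $a>_bM(b)$; stable matching: no blocking edge in the table considered; $\mathcal{M}(T),\mathcal{S}(\cdot)$: matchings and stable matchings. Subtable: subset of edges with induced orders. A matching $M'$ blocks $M$ if an edge of $M'$ blocks $M$. A set of matchings is internally stable if no two members block each other; $\mathcal{M}'\subseteq\mathcal{M}(T)$ is internally closed if it is internally stable and every $M\in\mathcal{M}(T)$ with $\{M\}\cup\mathcal{M}'$ internally stable lies in $\mathcal{M}'$. -}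

module Defs where

open import Level using (Level; _⊔_) renaming (suc to lsuc; zero to lzero)
open import Data.Nat using (ℕ; _<_)
open import Data.Fin using (Fin)
open import Data.Maybe using (Maybe; just; nothing)
open import Data.Vec using (Vec; lookup)
open import Data.Product using (Σ; _×_; ∃; ∃-syntax)
open import Data.Sum using (_⊎_)
open import Data.Empty using (⊥)
open import Data.Unit using (⊤)
open import Relation.Nullary using (¬_)
open import Relation.Binary.PropositionalEquality using (_≡_)
open import Function.Bundles using (_⇔_)

-- A "table" on n agents is an acceptability relation
-- (the edges); preferences are encoded by a rank function: agent a prefers
-- b to c  iff  rank a b < rank a c  (smaller rank = more preferred).
-- A subtable keeps the same ranks (induced orders) on a subset of edges.

record RoommateInstance (n : ℕ) : Set₁ where
  field
    Acc   : Fin n → Fin n → Set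
    rank  : Fin n → Fin n → ℕ
    sym   : ∀ a b → Acc a b → Acc b a
    irrefl : ∀ a → ¬ Acc a a
    rank-inj : ∀ a b c → Acc a b → Acc a c → rank a b ≡ rank a c → b ≡ c

-- A (candidate) matching: partner vector; nothing = unmatched (∅).
Assignment : ℕ → Set
Assignment n = Vec (Maybe (Fin n)) n

module _ {n : ℕ} (rank : Fin n → Fin n → ℕ) where

  Prefers : Fin n → Fin n → Maybe (Fin n) → Set
  Prefers a b nothing  = ⊤
  Prefers a b (just c) = rank a b < rank a c

  module _ (E : Fin n → Fin n → Set) where

    IsMatching : Assignment n → Set
    IsMatching M = ∀ a b → lookup M a ≡ just b → E a b × lookup M b ≡ just a

    BlockingEdge : Assignment n → Fin n → Fin n → Set
    BlockingEdge M a b =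
      E a b × Prefers a b (lookup M a) × Prefers b a (lookup M b)

    IsStable : Assignment n → Set
    IsStable M = ¬ (∃[ a ] ∃[ b ] BlockingEdge M a b)

module _ {n : ℕ} (T : RoommateInstance n) where
  open RoommateInstance T

  𝓜 : Assignment n → Set
  𝓜 = IsMatching rank Acc

  Blocks : Assignment n → Assignment n → Set
  Blocks M' M = ∃[ a ] ∃[ b ] (lookup M' a ≡ just b × BlockingEdge rank Acc M a b)

  InternallyStable : (Assignment n → Set) → Set
  InternallyStable 𝓢 = ∀ M₁ M₂ → 𝓢 M₁ → 𝓢 M₂ → ¬ Blocks M₁ M₂

  InternallyClosed : (Assignment n → Set) → Set
  InternallyClosed 𝓢 =
    InternallyStable 𝓢 ×
    (∀ M → 𝓜 M → InternallyStable (λ X → X ≡ M ⊎ 𝓢 X) → 𝓢 M)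

  SubEdges : (Assignment n → Set) → Fin n → Fin n → Set
  SubEdges 𝓢 a b = Acc a b × ∃[ M ] (𝓢 M × lookup M a ≡ just b)

  𝓢Sub : (Assignment n → Set) → Assignment n → Set
  𝓢Sub 𝓢 M = IsMatching rank (SubEdges 𝓢) M × IsStable rank (SubEdges 𝓢) M

module Submission where

open import Defs
open import Data.Nat using (ℕ)
open import Data.Nat.Properties using (<-irrefl)
open import Data.Product using (_,_; proj₁; proj₂)
open import Data.Sum using (_⊎_; inj₁; inj₂)
open import Relation.Nullary using (¬_)
open import Relation.Binary.PropositionalEquality using (_≡_; refl)
open import Function.Bundles using (_⇔_; mk⇔; Equivalence)

-- Every edge of T̃ lies in some member of 𝓜', so stability in T̃ says exactly that
-- no member of 𝓜' blocks M.  A matching of T̃ blocks M₂ only along an edge of some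
-- member, which would then block M₂ too; so a stable matching of T̃ can be adjoined
-- to 𝓜' keeping it internally stable, and internal closure puts it in 𝓜'.

module _ {n : ℕ} (T : RoommateInstance n) where
  open RoommateInstance T

  ¬Blocks-self : ∀ M → ¬ Blocks T M M
  ¬Blocks-self M (a , b , Ma≡b , _ , b>aMa , _) rewrite Ma≡b = <-irrefl refl b>aMa

  module _ (𝓜' : Assignment n → Set) where

    member-isMatching-sub : ∀ M → 𝓜 T M → 𝓜' M → IsMatching rank (SubEdges T 𝓜') M
    member-isMatching-sub M M-match M∈ a b Ma≡b =
      (proj₁ (M-match a b Ma≡b) , M , M∈ , Ma≡b) , proj₂ (M-match a b Ma≡b)

    isMatching-sub⇒𝓜 : ∀ M → IsMatching rank (SubEdges T 𝓜') M → 𝓜 T M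
    isMatching-sub⇒𝓜 M M-match a b Ma≡b =
      proj₁ (proj₁ (M-match a b Ma≡b)) , proj₂ (M-match a b Ma≡b)

    isStable-sub⇔unblocked : ∀ M →
      IsStable rank (SubEdges T 𝓜') M ⇔ (∀ M' → 𝓜' M' → ¬ Blocks T M' M)
    isStable-sub⇔unblocked M = mk⇔ to from
      where
      to : IsStable rank (SubEdges T 𝓜') M → ∀ M' → 𝓜' M' → ¬ Blocks T M' M
      to stable M' M'∈ (a , b , M'a≡b , ab , pa , pb) =
        stable (a , b , (ab , M' , M'∈ , M'a≡b) , pa , pb)
      from : (∀ M' → 𝓜' M' → ¬ Blocks T M' M) → IsStable rank (SubEdges T 𝓜') M
      from unblocked (a , b , (ab , M' , M'∈ , M'a≡b) , pa , pb) =
        unblocked M' M'∈ (a , b , M'a≡b , ab , pa , pb)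

    matching-sub-blocks-only-if-member-blocks : ∀ M M₂ →
      IsMatching rank (SubEdges T 𝓜') M →
      (∀ M' → 𝓜' M' → ¬ Blocks T M' M₂) → ¬ Blocks T M M₂
    matching-sub-blocks-only-if-member-blocks M M₂ M-match unblocked
      (a , b , Ma≡b , ab , pa , pb) with M-match a b Ma≡b
    ... | (_ , M' , M'∈ , M'a≡b) , _ = unblocked M' M'∈ (a , b , M'a≡b , ab , pa , pb)

    adjoin-internallyStable : ∀ M → IsMatching rank (SubEdges T 𝓜') M →
      IsStable rank (SubEdges T 𝓜') M → InternallyStable T 𝓜' →
      InternallyStable T (λ X → X ≡ M ⊎ 𝓜' X)
    adjoin-internallyStable M M-match stable ist = adjoined
      where
      unblocked : ∀ M' → 𝓜' M' → ¬ Blocks T M' M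
      unblocked = Equivalence.to (isStable-sub⇔unblocked M) stable
      adjoined : InternallyStable T (λ X → X ≡ M ⊎ 𝓜' X)
      adjoined _  _  (inj₁ refl) (inj₁ refl) = ¬Blocks-self M
      adjoined M₁ _  (inj₂ M₁∈)  (inj₁ refl) = unblocked M₁ M₁∈
      adjoined _  M₂ (inj₁ refl) (inj₂ M₂∈)  =
        matching-sub-blocks-only-if-member-blocks M M₂ M-match
          (λ M' M'∈ → ist M' M₂ M'∈ M₂∈)
      adjoined M₁ M₂ (inj₂ M₁∈)  (inj₂ M₂∈)  = ist M₁ M₂ M₁∈ M₂∈

lemma3 : ∀ {n : ℕ} (T : RoommateInstance n) (𝓜' : Assignment n → Set) →
    (∀ M → 𝓜' M → 𝓜 T M) →
    InternallyClosed T 𝓜' →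
    ∀ M → 𝓜' M ⇔ 𝓢Sub T 𝓜' M
lemma3 T 𝓜' members-match (ist , closed) M = mk⇔ to from
  where
  to : 𝓜' M → 𝓢Sub T 𝓜' M
  to M∈ = member-isMatching-sub T 𝓜' M (members-match M M∈) M∈
        , Equivalence.from (isStable-sub⇔unblocked T 𝓜' M) (λ M' M'∈ → ist M' M M'∈ M∈)
  from : 𝓢Sub T 𝓜' M → 𝓜' M
  from (M-match , stable) =
    closed M (isMatching-sub⇒𝓜 T 𝓜' M M-match)
      (adjoin-internallyStable T 𝓜' M M-match stable ist)
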